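{- There are non-isomorphic graphs $G$, $H$ such that the system of linear equations $\operatorname{MLIN}(\mathsf P_{\mathrm{iso}}(G,H)^2)$ has a solution over $\mathbb Z$ (i.e. an integer assignment to its variables satisfying all its equations).
   Context: A local isomorphism from $G$ to $H$ is an injective map $\pi$ with domain contained in $V(G)$ and range in $V(H)$ (viewed as a subset of $V(G)\times V(H)$) such that $vv'\in E(G)\iff\pi(v)\pi(v')\in E(H)$ for all $v,v'$ in its domain. Standing assumption: $|V(G)|\ge2$ or $|V(H)|\ge 2$. $\mathsf P_{\mathrm{iso}}(G,H)$ is the set of polynomials (each $p$ standing for $p=0$) in variables $x_{vw}$ ($v\in V(G)$, $w\in V(H)$): $\sum_{v\in V(G)}x_{vw}-1$ for all $w\in V(H)$; $\sum_{w\in V(H)}x_{vw}-1$ for all $v\in V(G)$; $x_{vw}x_{v'w'}$ for all $v,v',w,w'$ such that $\{(v,w),(v',w')\}$ is not a local isomorphism. For a set $\mathsf P$ of polynomials, $\mathsf P^r$ is the set of all polynomials of degree at most $r$ obtained by multiplying a polynomial of $\mathsf P$ by a monomial (including the monomial $1$). $\operatorname{MLIN}(\mathsf P)$ is the system of linear equations obtained by replacing each monomial $x_{i_1}\cdots x_{i_\ell}$ by a new variable $X_{\{i_1,\dots,i_\ell\}}$ (indexed by the set of variables occurring, so e.g. $x_i^2$ becomes $X_{\{i\}}$), constants being kept; each resulting linear polynomial is set equal to $0$. -}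

module Defs where

open import Data.Nat using (ℕ; _≤_; _⊔_)
open import Data.Bool using (Bool; false)
open import Data.Fin using (Fin)
open import Data.Integer using (ℤ; _+_; _*_; -_; 0ℤ; 1ℤ)
open import Data.List using (List; []; _∷_; _++_; map; foldr; length; allFin)
open import Data.List.Membership.Propositional using (_∈_)
open import Data.Product using (_×_; _,_; Σ; ∃)
open import Function.Bundles using (_↔_; Inverse)
open import Relation.Binary.PropositionalEquality using (_≡_)
import Data.Empty

record Graph : Set where
  field
    size   : ℕ
    adj    : Fin size → Fin size → Bool
    sym    : ∀ u v → adj u v ≡ adj v u
    irrefl : ∀ v → adj v v ≡ false
open Graph public

_≅_ : Graph → Graph → Set
G ≅ H = Σ (Fin (size G) ↔ Fin (size H)) λ f →
          ∀ u v → adj G u v ≡ adj H (Inverse.to f u) (Inverse.to f v)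

-- Polynomials over ℤ in variables of type V, as lists of terms
-- (coefficient , monomial); a monomial is a list of variables (product).

Monomial : Set → Set
Monomial V = List V

Poly : Set → Set
Poly V = List (ℤ × Monomial V)

_·ₘ_ : ∀ {V} → Poly V → Monomial V → Poly V
p ·ₘ m = map (λ { (c , μ) → (c , μ ++ m) }) p

-- degree: maximum length of the monomials occurring.  (For all polynomials
-- arising below there is no cancellation between terms, so this is the
-- actual degree.)
deg : ∀ {V} → Poly V → ℕ
deg = foldr (λ { (_ , μ) d → length μ ⊔ d }) 0

Power : ∀ {V} → (Poly V → Set) → ℕ → Poly V → Set
Power {V} P r q = Σ (Poly V) λ p → Σ (Monomial V) λ m →
                    P p × (q ≡ p ·ₘ m) × (deg q ≤ r)

-- Assignments to the MLIN variables X_S, S a (nonempty) set of variables.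
-- Represented as a function on monomials that only depends on the set of
-- variables occurring in the monomial.
record MAssignment (V : Set) : Set where
  field
    X    : Monomial V → ℤ
    resp : ∀ μ ν → (∀ x → x ∈ μ → x ∈ ν) → (∀ x → x ∈ ν → x ∈ μ) → X μ ≡ X ν
open MAssignment public

evalMLIN : ∀ {V} → MAssignment V → Poly V → ℤ
evalMLIN a [] = 0ℤ
evalMLIN a ((c , []) ∷ p) = c + evalMLIN a p
evalMLIN a ((c , μ@(_ ∷ _)) ∷ p) = c * X a μ + evalMLIN a p

SolvesMLIN : ∀ {V} → (Poly V → Set) → MAssignment V → Set
SolvesMLIN P a = ∀ p → P p → evalMLIN a p ≡ 0ℤ

IsoVar : Graph → Graph → Set
IsoVar G H = Fin (size G) × Fin (size H)

IsLocIso₂ : (G H : Graph) → Fin (size G) → Fin (size H) → Fin (size G) → Fin (size H) → Set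
IsLocIso₂ G H v w v' w' =
  (v ≡ v' → w ≡ w') × (w ≡ w' → v ≡ v') ×
  (adj G v v' ≡ adj H w w') × (adj G v' v ≡ adj H w' w)

data Piso (G H : Graph) : Poly (IsoVar G H) → Set where
  colEq : (w : Fin (size H)) →
    Piso G H (map (λ v → (1ℤ , (v , w) ∷ [])) (allFin (size G)) ++ ((- 1ℤ , []) ∷ []))
  rowEq : (v : Fin (size G)) →
    Piso G H (map (λ w → (1ℤ , (v , w) ∷ [])) (allFin (size H)) ++ ((- 1ℤ , []) ∷ []))
  nonIso : ∀ v w v' w' → (IsLocIso₂ G H v w v' w' → Data.Empty.⊥) →
    Piso G H ((1ℤ , (v , w) ∷ (v' , w') ∷ []) ∷ [])

-- G = three disjoint triangles and H = a triangle plus a hexagon are both 2-regular on nine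
-- vertices, but G is a disjoint union of cliques and H is not (the hexagon contains an induced
-- path), so G ≇ H.  Nevertheless the degree-2 multilinearised system has an explicit integer
-- solution.  Verifying it is a finite computation: multiplying an equation of P_iso by a
-- monomial of length ≥ 2 (≥ 1 for the quadratic equations) exceeds degree 2, so only finitely
-- many linear equations remain.

module Submission where

open import Defs
open import Data.Nat using (ℕ; _≤_; _<_; _≡ᵇ_; _*_; _+_; z≤n; s≤s)
open import Data.Nat.Properties using (≤-trans; ≤-antisym; ≤-reflexive; <-≤-trans; <⇒≱; m≤m⊔n; m≤n⊔m)
open import Data.Bool using (Bool; true; false; _∧_; _∨_; if_then_else_)
import Data.Bool.Properties as Bool
open import Data.Fin using (Fin; toℕ; fromℕ<; #_)
import Data.Fin.Properties as Fin
open import Data.Integer using (ℤ; 0ℤ; 1ℤ; -_)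
import Data.Integer.Properties as ℤ
open import Data.List using (List; []; _∷_; _++_; map; length; allFin)
open import Data.List.Properties using (length-++)
open import Data.List.Membership.Propositional using (_∈_)
open import Data.List.Membership.Propositional.Properties using (∈-map⁺; ∈-++⁺ˡ; ∈-allFin)
open import Data.List.Relation.Unary.Any using (here; there)
open import Data.List.Relation.Binary.Subset.Propositional using (_⊆_)
open import Data.List.Relation.Binary.Subset.Propositional.Properties using (map⁺)
open import Data.List.Extrema.Nat using (min; max; min-mono-⊆; max-mono-⊆)
open import Data.Product using (Σ; _×_; _,_; proj₁; proj₂)
open import Data.Sum using (_⊎_; inj₁; [_,_]′)
open import Data.Empty using (⊥-elim)
open import Function using (_∘_)
open import Function.Bundles using (Inverse)
open import Relation.Nullary using (¬_; Dec)
open import Relation.Nullary.Decidable using (True; ¬?; _×-dec_; _→-dec_; _⊎-dec_; toWitness)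
open import Relation.Binary.PropositionalEquality using (_≡_; _≢_; refl; trans; cong; cong₂) renaming (sym to ≡-sym)

linked : List (ℕ × ℕ) → ℕ → ℕ → Bool
linked [] u v = false
linked ((a , b) ∷ es) u v = ((a ≡ᵇ u) ∧ (b ≡ᵇ v) ∨ (a ≡ᵇ v) ∧ (b ≡ᵇ u)) ∨ linked es u v

linked-sym : ∀ es u v → linked es u v ≡ linked es v u
linked-sym [] u v = refl
linked-sym ((a , b) ∷ es) u v =
  cong₂ _∨_ (Bool.∨-comm ((a ≡ᵇ u) ∧ (b ≡ᵇ v)) _) (linked-sym es u v)

edgeGraph : (n : ℕ) (es : List (ℕ × ℕ)) →
  {True (Fin.all? λ (v : Fin n) → linked es (toℕ v) (toℕ v) Bool.≟ false)} → Graph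
edgeGraph n es {loopless} = record
  { size   = n
  ; adj    = λ u v → linked es (toℕ u) (toℕ v)
  ; sym    = λ u v → linked-sym es (toℕ u) (toℕ v)
  ; irrefl = toWitness loopless
  }

threeTriangles : Graph
threeTriangles = edgeGraph 9
  ((0 , 1) ∷ (0 , 2) ∷ (1 , 2) ∷ (3 , 4) ∷ (3 , 5) ∷ (4 , 5) ∷ (6 , 7) ∷ (6 , 8) ∷ (7 , 8) ∷ [])

triangleAndHexagon : Graph
triangleAndHexagon = edgeGraph 9
  ((0 , 1) ∷ (0 , 2) ∷ (1 , 2) ∷ (3 , 4) ∷ (4 , 5) ∷ (5 , 6) ∷ (6 , 7) ∷ (7 , 8) ∷ (8 , 3) ∷ [])

IsClusterGraph : Graph → Set
IsClusterGraph G =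
  ∀ u a b → adj G u a ≡ true → adj G u b ≡ true → a ≢ b → adj G a b ≡ true

module _ {G H : Graph} (iso : G ≅ H) where
  open Inverse (proj₁ iso)

  adj-from : ∀ x y → adj H x y ≡ adj G (from x) (from y)
  adj-from x y = ≡-sym (trans (proj₂ iso (from x) (from y))
                              (cong₂ (adj H) (strictlyInverseˡ x) (strictlyInverseˡ y)))

  from-injective : ∀ {x y} → from x ≡ from y → x ≡ y
  from-injective {x} {y} eq =
    trans (≡-sym (strictlyInverseˡ x)) (trans (cong to eq) (strictlyInverseˡ y))

  isClusterGraph-resp-≅ : IsClusterGraph G → IsClusterGraph H
  isClusterGraph-resp-≅ cluster u a b ua ub a≢b =
    trans (adj-from a b)
      (cluster (from u) (from a) (from b)
        (trans (≡-sym (adj-from u a)) ua) (trans (≡-sym (adj-from u b)) ub)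
        (a≢b ∘ from-injective))

threeTriangles-isClusterGraph : IsClusterGraph threeTriangles
threeTriangles-isClusterGraph =
  toWitness {a? = Fin.all? λ u → Fin.all? λ a → Fin.all? λ b →
    (adjacent u a →-dec adjacent u b →-dec ¬? (a Fin.≟ b) →-dec adjacent a b)} _
  where
  adjacent : ∀ x y → Dec (adj threeTriangles x y ≡ true)
  adjacent x y = adj threeTriangles x y Bool.≟ true

triangleAndHexagon-notClusterGraph : ¬ IsClusterGraph triangleAndHexagon
triangleAndHexagon-notClusterGraph cluster with cluster (# 4) (# 3) (# 5) refl refl (λ ())
... | ()

extremaAssignment : {V : Set} → (V → ℕ) → (ℕ → ℕ → ℤ) → MAssignment V
extremaAssignment {V} code f = record { X = λ μ → f (lowest μ) (highest μ) ; resp = sameSet }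
  where
  highest lowest : Monomial V → ℕ
  highest μ = max 0 (map code μ)
  lowest μ = min (highest μ) (map code μ)

  sameSet : ∀ μ ν → (∀ x → x ∈ μ → x ∈ ν) → (∀ x → x ∈ ν → x ∈ μ) →
            f (lowest μ) (highest μ) ≡ f (lowest ν) (highest ν)
  sameSet μ ν μ⊆ν ν⊆μ = cong₂ f same-lowest same-highest
    where
    codes⊆ : map code μ ⊆ map code ν
    codes⊆ = map⁺ code (μ⊆ν _)
    codes⊇ : map code ν ⊆ map code μ
    codes⊇ = map⁺ code (ν⊆μ _)
    same-highest : highest μ ≡ highest ν
    same-highest = ≤-antisym (max-mono-⊆ z≤n codes⊆) (max-mono-⊆ z≤n codes⊇)
    same-lowest : lowest μ ≡ lowest ν
    same-lowest = ≤-antisym (min-mono-⊆ (≤-reflexive same-highest) codes⊇)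
                            (min-mono-⊆ (≤-reflexive (≡-sym same-highest)) codes⊆)

length-≤-deg-·ₘ : ∀ {V} {c : ℤ} {μ : Monomial V} (p : Poly V) m →
  (c , μ) ∈ p → length μ + length m ≤ deg (p ·ₘ m)
length-≤-deg-·ₘ {μ = μ} (_ ∷ p) m (here refl) =
  ≤-trans (≤-reflexive (≡-sym (length-++ μ))) (m≤m⊔n _ (deg (p ·ₘ m)))
length-≤-deg-·ₘ ((_ , ν) ∷ p) m (there c,μ∈p) =
  ≤-trans (length-≤-deg-·ₘ p m c,μ∈p) (m≤n⊔m (length (ν ++ m)) _)

columnPoly : (G H : Graph) → Fin (size H) → Poly (IsoVar G H)
columnPoly G H w = map (λ v → (1ℤ , (v , w) ∷ [])) (allFin (size G)) ++ ((- 1ℤ , []) ∷ [])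

rowPoly : (G H : Graph) → Fin (size G) → Poly (IsoVar G H)
rowPoly G H v = map (λ w → (1ℤ , (v , w) ∷ [])) (allFin (size H)) ++ ((- 1ℤ , []) ∷ [])

isLocIso₂? : ∀ G H v w v′ w′ → Dec (IsLocIso₂ G H v w v′ w′)
isLocIso₂? G H v w v′ w′ =
  ((v Fin.≟ v′) →-dec (w Fin.≟ w′)) ×-dec ((w Fin.≟ w′) →-dec (v Fin.≟ v′)) ×-dec
  (adj G v v′ Bool.≟ adj H w w′) ×-dec (adj G v′ v Bool.≟ adj H w′ w)

solvesPower₂ : ∀ {G H} (a : MAssignment (IsoVar G H)) → 0 < size G → 0 < size H →
  (∀ w → evalMLIN a (columnPoly G H w ·ₘ []) ≡ 0ℤ) →
  (∀ w v w′ → evalMLIN a (columnPoly G H w ·ₘ ((v , w′) ∷ [])) ≡ 0ℤ) →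
  (∀ v → evalMLIN a (rowPoly G H v ·ₘ []) ≡ 0ℤ) →
  (∀ v v′ w → evalMLIN a (rowPoly G H v ·ₘ ((v′ , w) ∷ [])) ≡ 0ℤ) →
  (∀ v w v′ w′ → ¬ IsLocIso₂ G H v w v′ w′ → X a ((v , w) ∷ (v′ , w′) ∷ []) ≡ 0ℤ) →
  SolvesMLIN (Power (Piso G H) 2) a
solvesPower₂ {G} {H} a 0<G 0<H col₀ col₁ row₀ row₁ nonIso₀ = solves
  where
  exceeds : ∀ (p : Poly (IsoVar G H)) {c μ} m → (c , μ) ∈ p → 2 < length μ + length m →
            ¬ deg (p ·ₘ m) ≤ 2
  exceeds p m c,μ∈p 2<μm = <⇒≱ (<-≤-trans 2<μm (length-≤-deg-·ₘ p m c,μ∈p))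

  vertex-in-column : ∀ w → (1ℤ , (fromℕ< 0<G , w) ∷ []) ∈ columnPoly G H w
  vertex-in-column w = ∈-++⁺ˡ (∈-map⁺ (λ v → (1ℤ , (v , w) ∷ [])) (∈-allFin (fromℕ< 0<G)))

  vertex-in-row : ∀ v → (1ℤ , (v , fromℕ< 0<H) ∷ []) ∈ rowPoly G H v
  vertex-in-row v = ∈-++⁺ˡ (∈-map⁺ (λ w → (1ℤ , (v , w) ∷ [])) (∈-allFin (fromℕ< 0<H)))

  solves : SolvesMLIN (Power (Piso G H) 2) a
  solves _ (_ , [] , colEq w , refl , _) = col₀ w
  solves _ (_ , (v , w′) ∷ [] , colEq w , refl , _) = col₁ w v w′
  solves _ (_ , m@(_ ∷ _ ∷ _) , colEq w , refl , d) =
    ⊥-elim (exceeds (columnPoly G H w) m (vertex-in-column w) (s≤s (s≤s (s≤s z≤n))) d)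
  solves _ (_ , [] , rowEq v , refl , _) = row₀ v
  solves _ (_ , (v′ , w) ∷ [] , rowEq v , refl , _) = row₁ v v′ w
  solves _ (_ , m@(_ ∷ _ ∷ _) , rowEq v , refl , d) =
    ⊥-elim (exceeds (rowPoly G H v) m (vertex-in-row v) (s≤s (s≤s (s≤s z≤n))) d)
  solves _ (_ , [] , nonIso v w v′ w′ notLocIso , refl , _) =
    trans (ℤ.+-identityʳ _) (trans (ℤ.*-identityˡ _) (nonIso₀ v w v′ w′ notLocIso))
  solves _ (_ , m@(_ ∷ _) , nonIso v w v′ w′ _ , refl , d) =
    ⊥-elim (exceeds ((1ℤ , (v , w) ∷ (v′ , w′) ∷ []) ∷ []) m (here refl)
                    (s≤s (s≤s (s≤s z≤n))) d)

module Certificate where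
  open import Agda.Builtin.FromNat using (Number; fromNat)
  open import Agda.Builtin.FromNeg using (Negative; fromNeg)
  open import Data.Unit using (⊤; tt)
  import Data.Nat.Literals as ℕ
  import Data.Integer.Literals as ℤ

  private instance
    ℕ-number : Number ℕ
    ℕ-number = ℕ.number
    ℤ-number : Number ℤ
    ℤ-number = ℤ.number
    ℤ-negative : Negative ℤ
    ℤ-negative = ℤ.negative
    noConstraint : ⊤
    noConstraint = tt

  -- Row i lists the nonzero values (j , X) at (i , j), for j ≥ i.
  table : List (ℕ × List (ℕ × ℤ))
  table =
    (0 , (0 , 1) ∷ (10 , 1) ∷ (20 , 1) ∷ (30 , 7) ∷ (31 , -1) ∷ (32 , -10) ∷ (33 , 1) ∷ (34 , 2) ∷
         (35 , 2) ∷ (39 , -1) ∷ (41 , 2) ∷ (48 , -1) ∷ (50 , 2) ∷ (57 , -8) ∷ (58 , 2) ∷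
         (59 , 9) ∷ (61 , -1) ∷ (62 , -1) ∷ (66 , 2) ∷ (68 , -1) ∷ (75 , 2) ∷ (77 , -1) ∷ []) ∷
    (1 , (1 , -1) ∷ (9 , -1) ∷ (20 , -1) ∷ (30 , -1) ∷ (39 , -1) ∷ (48 , -1) ∷ (57 , 4) ∷
         (58 , -1) ∷ (59 , -1) ∷ (60 , -1) ∷ (61 , -1) ∷ (62 , -1) ∷ (66 , -1) ∷ (75 , -1) ∷ []) ∷
    (2 , (2 , -1) ∷ (10 , -1) ∷ (18 , -1) ∷ (30 , -1) ∷ (39 , -1) ∷ (48 , -1) ∷ (57 , 4) ∷
         (58 , -1) ∷ (59 , -1) ∷ (60 , -1) ∷ (61 , -1) ∷ (62 , -1) ∷ (66 , -1) ∷ (75 , -1) ∷ []) ∷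
    (3 , (3 , -1) ∷ (13 , -1) ∷ (26 , -1) ∷ (27 , -11) ∷ (28 , 3) ∷ (29 , 3) ∷ (32 , 8) ∷
         (33 , -2) ∷ (34 , -2) ∷ (36 , 1) ∷ (41 , -2) ∷ (45 , 1) ∷ (50 , -2) ∷ (54 , 8) ∷
         (56 , -4) ∷ (59 , -7) ∷ (60 , 1) ∷ (61 , 1) ∷ (63 , -2) ∷ (68 , 1) ∷ (72 , 2) ∷
         (73 , -4) ∷ (77 , 1) ∷ []) ∷
    (4 , (4 , 1) ∷ (12 , 1) ∷ (23 , 1) ∷ (27 , 1) ∷ (36 , 1) ∷ (45 , 1) ∷ (54 , -3) ∷ (56 , 1) ∷
         (60 , 1) ∷ (61 , 1) ∷ (62 , 1) ∷ (63 , 1) ∷ (73 , 1) ∷ []) ∷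
    (5 , (5 , 1) ∷ (13 , 1) ∷ (24 , 1) ∷ (27 , 6) ∷ (30 , -5) ∷ (36 , -2) ∷ (39 , 3) ∷ (45 , -2) ∷
         (48 , 3) ∷ (54 , -2) ∷ (56 , 1) ∷ (61 , 1) ∷ (62 , 1) ∷ (63 , 1) ∷ (73 , 1) ∷ []) ∷
    (6 , (6 , -1) ∷ (16 , -1) ∷ (23 , -1) ∷ (27 , 7) ∷ (28 , -2) ∷ (29 , -2) ∷ (30 , -1) ∷
         (31 , -1) ∷ (35 , -2) ∷ (36 , -1) ∷ (45 , -1) ∷ (54 , -3) ∷ (56 , 1) ∷ (62 , 1) ∷
         (63 , -1) ∷ (72 , -2) ∷ (73 , 1) ∷ []) ∷
    (7 , (7 , 1) ∷ (15 , 1) ∷ (26 , 1) ∷ (27 , -2) ∷ (30 , 1) ∷ (31 , 1) ∷ (32 , 1) ∷ (36 , 1) ∷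
         (45 , 1) ∷ (56 , 1) ∷ (63 , 1) ∷ (73 , 1) ∷ []) ∷
    (8 , (8 , 1) ∷ (16 , 1) ∷ (21 , 1) ∷ (27 , -2) ∷ (31 , 1) ∷ (32 , 1) ∷ (33 , 1) ∷ (36 , 1) ∷
         (45 , 1) ∷ (56 , 1) ∷ (63 , 1) ∷ (73 , 1) ∷ []) ∷
    (9 , (9 , -1) ∷ (20 , -1) ∷ (30 , -1) ∷ (31 , -1) ∷ (32 , 4) ∷ (33 , -1) ∷ (34 , -1) ∷
         (35 , -1) ∷ (41 , -1) ∷ (50 , -1) ∷ (59 , -1) ∷ (68 , -1) ∷ (77 , -1) ∷ []) ∷
    (10 , (18 , -1) ∷ (20 , 1) ∷ []) ∷
    (12 , (12 , 1) ∷ (26 , 1) ∷ (27 , 3) ∷ (32 , -4) ∷ (33 , 1) ∷ (34 , 1) ∷ (41 , 1) ∷ (50 , 1) ∷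
          (54 , -1) ∷ (56 , 1) ∷ (59 , 1) ∷ (68 , 1) ∷ (72 , -1) ∷ (73 , 1) ∷ (77 , 1) ∷ []) ∷
    (13 , (21 , 1) ∷ (23 , -1) ∷ []) ∷
    (15 , (15 , 1) ∷ (23 , 1) ∷ (27 , -4) ∷ (28 , 1) ∷ (29 , 1) ∷ (30 , 1) ∷ (31 , 1) ∷ (35 , 1) ∷
          (36 , 1) ∷ (45 , 1) ∷ (54 , 1) ∷ (63 , 1) ∷ (72 , 1) ∷ []) ∷
    (16 , (24 , 1) ∷ (26 , -1) ∷ []) ∷
    (18 , (18 , -1) ∷ (30 , -1) ∷ (31 , -1) ∷ (32 , 4) ∷ (33 , -1) ∷ (34 , -1) ∷ (35 , -1) ∷
          (41 , -1) ∷ (50 , -1) ∷ (59 , -1) ∷ (68 , -1) ∷ (77 , -1) ∷ []) ∷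
    (21 , (21 , 1) ∷ (27 , 3) ∷ (32 , -4) ∷ (33 , 1) ∷ (34 , 1) ∷ (41 , 1) ∷ (50 , 1) ∷
          (54 , -1) ∷ (56 , 1) ∷ (59 , 1) ∷ (68 , 1) ∷ (72 , -1) ∷ (73 , 1) ∷ (77 , 1) ∷ []) ∷
    (24 , (24 , 1) ∷ (27 , -4) ∷ (28 , 1) ∷ (29 , 1) ∷ (30 , 1) ∷ (31 , 1) ∷ (35 , 1) ∷ (36 , 1) ∷
          (45 , 1) ∷ (54 , 1) ∷ (63 , 1) ∷ (72 , 1) ∷ []) ∷
    (27 , (27 , -1) ∷ (37 , -1) ∷ (47 , -1) ∷ (57 , 8) ∷ (58 , -2) ∷ (59 , -9) ∷ (61 , 1) ∷
          (62 , 1) ∷ (66 , -2) ∷ (68 , 1) ∷ (75 , -2) ∷ (77 , 1) ∷ []) ∷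
    (28 , (28 , 1) ∷ (36 , 1) ∷ (47 , 1) ∷ (57 , -4) ∷ (58 , 1) ∷ (59 , 1) ∷ (60 , 1) ∷ (61 , 1) ∷
          (62 , 1) ∷ (66 , 1) ∷ (75 , 1) ∷ []) ∷
    (29 , (29 , 1) ∷ (37 , 1) ∷ (45 , 1) ∷ (57 , -4) ∷ (58 , 1) ∷ (59 , 1) ∷ (60 , 1) ∷ (61 , 1) ∷
          (62 , 1) ∷ (66 , 1) ∷ (75 , 1) ∷ []) ∷
    (30 , (54 , -6) ∷ (56 , 1) ∷ (59 , 7) ∷ (60 , -1) ∷ (61 , -1) ∷ (63 , 1) ∷ (68 , -1) ∷
          (73 , 1) ∷ (77 , -1) ∷ []) ∷
    (31 , (54 , 3) ∷ (60 , -1) ∷ (61 , -1) ∷ (62 , -1) ∷ []) ∷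
    (32 , (54 , 2) ∷ (61 , -1) ∷ (62 , -1) ∷ []) ∷
    (33 , (54 , 1) ∷ (62 , -1) ∷ []) ∷
    (36 , (36 , 1) ∷ (47 , 1) ∷ (59 , 1) ∷ (68 , 1) ∷ (77 , 1) ∷ []) ∷
    (37 , (45 , 1) ∷ (47 , -1) ∷ []) ∷
    (39 , (56 , 1) ∷ (59 , -1) ∷ (63 , 1) ∷ (68 , -1) ∷ (73 , 1) ∷ (77 , -1) ∷ []) ∷
    (45 , (45 , 1) ∷ (59 , 1) ∷ (68 , 1) ∷ (77 , 1) ∷ []) ∷
    (48 , (56 , 1) ∷ (59 , -1) ∷ (63 , 1) ∷ (68 , -1) ∷ (73 , 1) ∷ (77 , -1) ∷ []) ∷
    (56 , (56 , 1) ∷ (63 , 1) ∷ (73 , 1) ∷ []) ∷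
    (63 , (63 , 1) ∷ (73 , 1) ∷ []) ∷
    (73 , (73 , 1) ∷ []) ∷
    []

lookupOr : {A : Set} → A → List (ℕ × A) → ℕ → A
lookupOr d [] k = d
lookupOr d ((k′ , x) ∷ t) k = if k ≡ᵇ k′ then x else lookupOr d t k

tableEntry : List (ℕ × List (ℕ × ℤ)) → ℕ → ℕ → ℤ
tableEntry t i j = lookupOr 0ℤ (lookupOr [] t i) j

-- The variable x_vw gets the code 9v + w, and X_S is looked up at (least code, greatest
-- code) of S; this determines S whenever |S| ≤ 2, the only case occurring in degree 2.
solution : MAssignment (IsoVar threeTriangles triangleAndHexagon)
solution = extremaAssignment (λ (v , w) → 9 * toℕ v + toℕ w) (tableEntry Certificate.table)

vanishes? : ∀ p → Dec (evalMLIN solution p ≡ 0ℤ)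
vanishes? p = evalMLIN solution p ℤ.≟ 0ℤ

column-vanishes : ∀ w →
  evalMLIN solution (columnPoly threeTriangles triangleAndHexagon w ·ₘ []) ≡ 0ℤ
column-vanishes = toWitness {a? = Fin.all? λ w →
  vanishes? (columnPoly threeTriangles triangleAndHexagon w ·ₘ [])} _

column-times-vanishes : ∀ w v w′ →
  evalMLIN solution (columnPoly threeTriangles triangleAndHexagon w ·ₘ ((v , w′) ∷ [])) ≡ 0ℤ
column-times-vanishes = toWitness {a? = Fin.all? λ w → Fin.all? λ v → Fin.all? λ w′ →
  vanishes? (columnPoly threeTriangles triangleAndHexagon w ·ₘ ((v , w′) ∷ []))} _

row-vanishes : ∀ v →
  evalMLIN solution (rowPoly threeTriangles triangleAndHexagon v ·ₘ []) ≡ 0ℤ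
row-vanishes = toWitness {a? = Fin.all? λ v →
  vanishes? (rowPoly threeTriangles triangleAndHexagon v ·ₘ [])} _

row-times-vanishes : ∀ v v′ w →
  evalMLIN solution (rowPoly threeTriangles triangleAndHexagon v ·ₘ ((v′ , w) ∷ [])) ≡ 0ℤ
row-times-vanishes = toWitness {a? = Fin.all? λ v → Fin.all? λ v′ → Fin.all? λ w →
  vanishes? (rowPoly threeTriangles triangleAndHexagon v ·ₘ ((v′ , w) ∷ []))} _

locIso-or-vanishes : ∀ v w v′ w′ →
  IsLocIso₂ threeTriangles triangleAndHexagon v w v′ w′ ⊎ X solution ((v , w) ∷ (v′ , w′) ∷ []) ≡ 0ℤ
locIso-or-vanishes = toWitness {a? = Fin.all? λ v → Fin.all? λ w → Fin.all? λ v′ → Fin.all? λ w′ →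
  isLocIso₂? threeTriangles triangleAndHexagon v w v′ w′ ⊎-dec
  X solution ((v , w) ∷ (v′ , w′) ∷ []) ℤ.≟ 0ℤ} _

solution-solves : SolvesMLIN (Power (Piso threeTriangles triangleAndHexagon) 2) solution
-- The graphs are passed explicitly: inferring them would make Agda normalise the evalMLIN terms.
solution-solves = solvesPower₂ {threeTriangles} {triangleAndHexagon} solution (s≤s z≤n) (s≤s z≤n)
  column-vanishes column-times-vanishes
  row-vanishes row-times-vanishes
  (λ v w v′ w′ notLocIso →
     [ ⊥-elim ∘ notLocIso , (λ vanishing → vanishing) ]′ (locIso-or-vanishes v w v′ w′))

theorem5 : Σ Graph λ G → Σ Graph λ H →
    ((2 ≤ size G) ⊎ (2 ≤ size H)) × ¬ (G ≅ H) ×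
    Σ (MAssignment (IsoVar G H)) λ a → SolvesMLIN (Power (Piso G H) 2) a
theorem5 =
  threeTriangles , triangleAndHexagon , inj₁ (s≤s (s≤s z≤n)) ,
  (λ iso → triangleAndHexagon-notClusterGraph
             (isClusterGraph-resp-≅ {threeTriangles} {triangleAndHexagon} iso
                                     threeTriangles-isClusterGraph)) ,
  solution , solution-solves
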